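{- Let the edges of the complete $4$-uniform hypergraph $\mathcal{H}=\mathcal{K}^4_{N}$ be colored red and blue. Let $\mathcal{P}$ be a red loose path in $\mathcal{H}$ which is maximal with respect to $W$, where $W\subseteq V(\mathcal{H})\setminus V(\mathcal{P})$ and $|W|\geq 4$. Then for every two consecutive edges $e_1,e_2$ of $\mathcal{P}$ there is a blue good $\varpi_S$-configuration $C=fg$ (with edges $f=\{x,a_1,a_2,a_3\}$, $g=\{a_3,a_4,a_5,y\}$, $S=\{a_1,\dots,a_5\}$) with end vertices $x\in f$ and $y\in g$ in $W$ and $S\subseteq e_1\cup e_2$, where good means that at least one vertex of $e_2\setminus e_1$ is not in $S$. Moreover, there are subsets $W_1,W_2\subseteq W$ with $|W_1|\geq |W|-2$ and $|W_2|\geq |W|-3$ such that for all distinct $x'\in W_1$ and $y'\in W_2$, the path $C'=\big((f\setminus\{x\})\cup\{x'\}\big)\big((g\setminus\{y\})\cup\{y'\}\big)$ is also a blue good $\varpi_S$-configuration with end vertices $x'$ and $y'$ in $W$.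
   Context: A $4$-uniform loose path $\mathcal{P}=e_1e_2\ldots e_n$ has vertex set $\{v_1,\ldots,v_{3n+1}\}$ and edges $e_i=\{v_{3i-2},v_{3i-1},v_{3i},v_{3i+1}\}$; the first vertex of $e_i$ is $f_{\mathcal{P},e_i}=v_{3i-2}$ and its last vertex is $l_{\mathcal{P},e_i}=v_{3i+1}$. For a loose path $\mathcal{P}$ and a vertex set $W$ disjoint from $V(\mathcal{P})$, a $\varpi_S$-configuration is a copy of the loose path $\mathcal{P}^4_2$ with edges $\{x,a_1,a_2,a_3\},\{a_3,a_4,a_5,y\}$, where $\{x,y\}\subseteq W$ (the end vertices) and $S=\{a_1,\dots,a_5\}\subseteq (e_{i-1}\setminus\{f_{\mathcal{P},e_{i-1}}\})\cup e_i\cup e_{i+1}$ for three consecutive edges of $\mathcal{P}$, with $|S\cap(e_{i-1}\setminus\{f_{\mathcal{P},e_{i-1}}\})|\le 1$; it is good if at least one vertex of $e_{i+1}\setminus e_i$ is not in $S$. A monochromatic loose path $\mathcal{P}=e_1\ldots e_n$ is maximal with respect to $W\subseteq V(\mathcal{H})\setminus V(\mathcal{P})$ if there is no $W'\subseteq W$ such that for some $1\le r\le n$ and $1\le i\le n-r+1$, $\mathcal{P}'=e_1\ldots e_{i-1}e'_ie'_{i+1}\ldots e'_{i+r}e_{i+r}\ldots e_n$ is a monochromatic (same color) loose path with $n+1$ edges satisfying: (i) $V(\mathcal{P}')=V(\mathcal{P})\cup W'$; (ii) if $i=1$ then $f_{\mathcal{P}',e'_i}=f_{\mathcal{P},e_i}$;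 (iii) if $i+r-1=n$ then $l_{\mathcal{P}',e'_{i+r}}=l_{\mathcal{P},e_n}$. -}

module Defs where

open import Data.Nat using (ℕ; zero; suc; _+_; _*_; _∸_; _≤_; _<_)
open import Data.Fin using (Fin)
open import Data.Fin.Subset using (Subset; ⁅_⁆; _∪_; _∈_; _∉_; _⊆_; ∣_∣)
open import Data.List using (List; []; _∷_)
open import Data.List.Relation.Unary.Unique.Propositional using (Unique)
open import Data.Product using (Σ; ∃; _×_; _,_)
open import Data.Sum using (_⊎_)
open import Relation.Binary.PropositionalEquality using (_≡_; _≢_)
open import Relation.Nullary using (¬_)
open import Function.Bundles using (_⇔_)

data Colour : Set where
  red blue : Colour

-- Edges are 4-element subsets; the colouring is a map on
-- subsets, of which only the values on 4-element subsets are ever used.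
Colouring : ℕ → Set
Colouring N = Subset N → Colour

quad : ∀ {N} → Fin N → Fin N → Fin N → Fin N → Subset N
quad a b c d = ⁅ a ⁆ ∪ (⁅ b ⁆ ∪ (⁅ c ⁆ ∪ ⁅ d ⁆))

-- A loose path with n edges is given by its vertex sequence v_0,...,v_{3n}
-- (0-indexed; only the values at indices ≤ 3n matter), which must be
-- pairwise distinct.
IsLoosePath : ∀ {N} → ℕ → (ℕ → Fin N) → Set
IsLoosePath n v = ∀ k l → k ≤ 3 * n → l ≤ 3 * n → v k ≡ v l → k ≡ l

edge : ∀ {N} → (ℕ → Fin N) → ℕ → Subset N
edge v j = quad (v (3 * j)) (v (3 * j + 1)) (v (3 * j + 2)) (v (3 * j + 3))

InPath : ∀ {N} → ℕ → (ℕ → Fin N) → Fin N → Set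
InPath n v u = ∃ λ k → k ≤ 3 * n × v k ≡ u

Monochromatic : ∀ {N} → Colouring N → Colour → ℕ → (ℕ → Fin N) → Set
Monochromatic c col n v = ∀ j → j < n → c (edge v j) ≡ col

-- P' (n+1 edges, vertex sequence w) is an extension of P (n edges, vertex
-- sequence v) as in the definition of maximality, with 1-indexed parameters
-- i = i₀ + 1 and r:  P' = e_1 … e_{i-1} e'_i … e'_{i+r} e_{i+r} … e_n.
IsExtension : ∀ {N} → Colouring N → Colour → Subset N →
              ℕ → (ℕ → Fin N) → ℕ → ℕ → (ℕ → Fin N) → Set
IsExtension {N} c col W n v i₀ r w =
  Σ (Subset N) λ W' →
    W' ⊆ W
  × 1 ≤ r × r ≤ n × i₀ + r ≤ n
  × IsLoosePath (suc n) w
  × Monochromatic c col (suc n) w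
  × (∀ j → j < i₀ → edge w j ≡ edge v j)
  × (∀ j → i₀ + r < j → j ≤ n → edge w j ≡ edge v (j ∸ 1))
  × (∀ u → InPath (suc n) w u ⇔ (InPath n v u ⊎ u ∈ W'))
  × (i₀ ≡ 0 → w 0 ≡ v 0)
  × (i₀ + r ≡ n → w (3 * suc n) ≡ v (3 * n))

Maximal : ∀ {N} → Colouring N → Colour → Subset N → ℕ → (ℕ → Fin N) → Set
Maximal c col W n v =
  ¬ (∃ λ i₀ → ∃ λ r → ∃ λ w → IsExtension c col W n v i₀ r w)

BlueGoodConfig : ∀ {N} → Colouring N → Subset N → (ℕ → Fin N) → ℕ →
                 Fin N → Fin N → Fin N → Fin N → Fin N → Fin N → Fin N → Set
BlueGoodConfig c W v j x a1 a2 a3 a4 a5 y =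
    Unique (x ∷ a1 ∷ a2 ∷ a3 ∷ a4 ∷ a5 ∷ y ∷ [])
  × x ∈ W × y ∈ W
  × c (quad x a1 a2 a3) ≡ blue
  × c (quad a3 a4 a5 y) ≡ blue
  × (S ⊆ (edge v j ∪ edge v (suc j)))
  × (∃ λ u → u ∈ edge v (suc j) × u ∉ edge v j × u ∉ S)
  where
  S = ⁅ a1 ⁆ ∪ (⁅ a2 ⁆ ∪ (⁅ a3 ⁆ ∪ (⁅ a4 ⁆ ∪ ⁅ a5 ⁆)))

module Submission where

-- Let p₀ … p₆ be the vertices of two consecutive edges eⱼ = p₀p₁p₂p₃ and eⱼ₊₁ = p₃p₄p₅p₆ of the
-- maximal red path.  Replacing these two edges by three edges that run from p₀ to p₆ through
-- p₁ … p₅ in another order and through three new vertices x, y, z ∈ W gives a loose path with one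
-- edge more, so by maximality the three new edges are never all red.  Each new edge has the form
-- {X} ∪ T for a new vertex X and a triple T of old vertices, and a pigeonhole argument shows that
-- for one of the three triples T the edge {X} ∪ T is blue for all X ∈ W except at most two.  Three
-- suitable reroutings yield three such blue triples, and in every case two of them share exactly one
-- vertex and together miss a vertex of eⱼ₊₁ ∖ eⱼ: they form the required configuration, with end
-- vertices ranging over the two large subsets of W.

open import Defs
open import Algebra.Bundles using (CommutativeMonoid)
open import Data.Bool.Properties using (∨-zeroʳ; ∨-identityʳ)
open import Data.Empty using (⊥; ⊥-elim)
open import Data.Fin using (Fin; zero; suc; toℕ; inject₁)
import Data.Fin as Fin
open import Data.Fin.Patterns using (0F; 1F; 2F; 3F; 4F; 5F; 6F)
open import Data.Fin.Permutation using (Permutation′; permutation; _⟨$⟩ʳ_; _⟨$⟩ˡ_; inverseˡ; inverseʳ)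
open import Data.Fin.Properties using (any?; all?; toℕ<n; toℕ-injective; toℕ-inject₁; toℕ≤pred[n])
open import Data.Fin.Subset using (Subset; ⁅_⁆; _∪_; _∈_; _∉_; _⊆_; ∣_∣; _-_; _─_; inside; outside; Nonempty)
open import Data.Fin.Subset.Properties
  using (∪-comm; ∪-identityʳ; ∪-commutativeMonoid; x∈p∪q⁻; x∈p∪q⁺; x∈⁅x⁆; x∈⁅y⁆⇒x≡y; x∈p∧x≢y⇒x∈p-y; p─q⊆p;
         ∣p∣≤∣x∷p∣; p⊆q⇒∣p∣≤∣q∣; ⊆-antisym; nonempty?; Empty-unique; ∣⊥∣≡0; _∈?_)
open import Data.List using (List; []; _∷_; map; _++_)
open import Data.List.Membership.Propositional using (find) renaming (_∈_ to _∈ₗ_; _∉_ to _∉ₗ_)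
open import Data.List.Membership.Propositional.Properties using (∈-map⁺; ∈-map⁻)
open import Data.List.Membership.DecPropositional (Fin._≟_ {7}) using (_∉?_)
open import Data.List.Relation.Unary.Any using (here; there)
import Data.List.Relation.Unary.Any as Any
open import Data.List.Relation.Unary.All using ([]; _∷_; tabulate)
open import Data.List.Relation.Unary.All.Properties using (++⁺)
open import Data.List.Relation.Unary.AllPairs using ([]; _∷_)
open import Data.List.Relation.Unary.Unique.Propositional using (Unique)
import Data.List.Relation.Unary.Unique.Propositional.Properties as Unique
open import Data.List.Relation.Unary.Unique.DecPropositional (Fin._≟_ {7}) using (unique?)
open import Data.List.Relation.Binary.Subset.Propositional using () renaming (_⊆_ to _⊆ₗ_)
open import Data.List.Relation.Binary.Subset.Propositional.Properties using (∷⁺ʳ) renaming (map⁺ to ⊆-map⁺)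
open import Data.List.Relation.Binary.Subset.DecPropositional (Fin._≟_ {7}) using (_⊆?_)
open import Data.Nat using (ℕ; zero; suc; _+_; _*_; _∸_; _≤_; _<_; z≤n; s≤s; s≤s⁻¹; _≤?_; _<?_)
open import Data.Nat.Properties
  using (≤-refl; ≤-trans; <-trans; n≤1+n; n<1+n; m≤m+n; ≤ᵇ⇒≤; ≰⇒>; ≮⇒≥; >⇒≢; +-suc; +-assoc; +-comm; +-identityʳ;
         *-suc; +-monoʳ-≤; +-mono-≤; *-monoʳ-≤; +-cancelˡ-≤; +-cancelˡ-≡; ∸-monoˡ-≤; ∸-monoʳ-≤; m∸n≤m;
         m≤n⇒m∸n≡0; m+n∸m≡n; m+[n∸m]≡n; m∸n+n≡m; module ≤-Reasoning)
open import Data.Nat.Tactic.RingSolver using (solve-∀)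
open import Data.Product using (Σ; Σ-syntax; ∃; _×_; _,_)
open import Data.Sum using (_⊎_; inj₁; inj₂)
import Data.Sum as Sum
open import Data.Unit using (⊤; tt)
open import Data.Vec using (Vec; lookup; _∷_; [])
import Data.Vec.Base as Vec
open import Function using (_∘_; _∘′_; _$_)
open import Function.Bundles using (_⇔_; mk⇔)
open import Relation.Binary.PropositionalEquality hiding (J)
open import Relation.Nullary using (Dec; yes; no)
open import Relation.Nullary.Decidable using (True; toWitness; _×-dec_)
open import Relation.Nullary.Negation using (contradiction)

-- Four-sets and finite subsets

private variable
  N : ℕ

∈-quad⁻ : ∀ {a b c d u : Fin N} → u ∈ quad a b c d → u ∈ₗ (a ∷ b ∷ c ∷ d ∷ [])
∈-quad⁻ {a = a} {b} {c} {d} u∈ with x∈p∪q⁻ ⁅ a ⁆ _ u∈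
... | inj₁ u∈a = here (x∈⁅y⁆⇒x≡y a u∈a)
... | inj₂ u∈bcd with x∈p∪q⁻ ⁅ b ⁆ _ u∈bcd
...   | inj₁ u∈b = there (here (x∈⁅y⁆⇒x≡y b u∈b))
...   | inj₂ u∈cd with x∈p∪q⁻ ⁅ c ⁆ _ u∈cd
...     | inj₁ u∈c = there (there (here (x∈⁅y⁆⇒x≡y c u∈c)))
...     | inj₂ u∈d = there (there (there (here (x∈⁅y⁆⇒x≡y d u∈d))))

∈-quad⁺ : ∀ {a b c d u : Fin N} → u ∈ₗ (a ∷ b ∷ c ∷ d ∷ []) → u ∈ quad a b c d
∈-quad⁺ (here refl) = x∈p∪q⁺ (inj₁ (x∈⁅x⁆ _))
∈-quad⁺ (there (here refl)) = x∈p∪q⁺ (inj₂ (x∈p∪q⁺ (inj₁ (x∈⁅x⁆ _))))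
∈-quad⁺ (there (there (here refl))) = x∈p∪q⁺ (inj₂ (x∈p∪q⁺ (inj₂ (x∈p∪q⁺ (inj₁ (x∈⁅x⁆ _))))))
∈-quad⁺ (there (there (there (here refl)))) = x∈p∪q⁺ (inj₂ (x∈p∪q⁺ (inj₂ (x∈p∪q⁺ (inj₂ (x∈⁅x⁆ _))))))

∈-⁅⁆∪quad⁻ : ∀ {a b c d e u : Fin N} → u ∈ ⁅ a ⁆ ∪ quad b c d e → u ∈ₗ (a ∷ b ∷ c ∷ d ∷ e ∷ [])
∈-⁅⁆∪quad⁻ {a = a} u∈ with x∈p∪q⁻ ⁅ a ⁆ _ u∈
... | inj₁ u∈a = here (x∈⁅y⁆⇒x≡y a u∈a)
... | inj₂ u∈bcde = there (∈-quad⁻ u∈bcde)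

quad-cong : ∀ {a b c d a′ b′ c′ d′ : Fin N} → a ≡ a′ → b ≡ b′ → c ≡ c′ → d ≡ d′ → quad a b c d ≡ quad a′ b′ c′ d′
quad-cong refl refl refl refl = refl

quad⊆quad : ∀ {a b c d a′ b′ c′ d′ : Fin N} →
  (∀ {u} → u ∈ₗ (a ∷ b ∷ c ∷ d ∷ []) → u ∈ₗ (a′ ∷ b′ ∷ c′ ∷ d′ ∷ [])) →
  quad a b c d ⊆ quad a′ b′ c′ d′
quad⊆quad sub = ∈-quad⁺ ∘′ sub ∘′ ∈-quad⁻

module _ {N : ℕ} where
  open import Algebra.Properties.CommutativeSemigroup (CommutativeMonoid.commutativeSemigroup (∪-commutativeMonoid N))
    using (x∙yz≈y∙xz)

  quad-pull₃ : ∀ (a b x d : Fin N) → quad a b x d ≡ quad x a b d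
  quad-pull₃ a b x d = trans (cong (⁅ a ⁆ ∪_) (x∙yz≈y∙xz ⁅ b ⁆ ⁅ x ⁆ ⁅ d ⁆)) (x∙yz≈y∙xz ⁅ a ⁆ ⁅ x ⁆ _)

  quad-pull₄ : ∀ (a b c x : Fin N) → quad a b c x ≡ quad x a b c
  quad-pull₄ a b c x = trans (cong (λ s → ⁅ a ⁆ ∪ (⁅ b ⁆ ∪ s)) (∪-comm ⁅ c ⁆ ⁅ x ⁆)) (quad-pull₃ a b x c)

x∈p─q⇒x∉q : ∀ {p q : Subset N} {x} → x ∈ p ─ q → x ∉ q
x∈p─q⇒x∉q {p = _ ∷ _} {inside ∷ _} {zero} ()
x∈p─q⇒x∉q {p = _ ∷ _} {outside ∷ _} {zero} _ ()
x∈p─q⇒x∉q {p = _ ∷ _} {_ ∷ _} {suc x} (Vec.there x∈p─q) (Vec.there x∈q) = x∈p─q⇒x∉q x∈p─q x∈q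

x∈p-y⇒x≢y : ∀ {p : Subset N} {x y} → x ∈ p - y → x ≢ y
x∈p-y⇒x≢y x∈p-y refl = x∈p─q⇒x∉q x∈p-y (x∈⁅x⁆ _)

p-x⊆p : ∀ {p : Subset N} {x} → p - x ⊆ p
p-x⊆p {p = p} = p─q⊆p p _

∣p∪⁅x⁆∣≤1+∣p∣ : ∀ (p : Subset N) x → ∣ p ∪ ⁅ x ⁆ ∣ ≤ suc ∣ p ∣
∣p∪⁅x⁆∣≤1+∣p∣ (b ∷ p) zero rewrite ∪-identityʳ p | ∨-zeroʳ b = s≤s (∣p∣≤∣x∷p∣ b p)
∣p∪⁅x⁆∣≤1+∣p∣ (b ∷ p) (suc x) rewrite ∨-identityʳ b with b
... | inside = s≤s (∣p∪⁅x⁆∣≤1+∣p∣ p x)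
... | outside = ∣p∪⁅x⁆∣≤1+∣p∣ p x

∣p∣≤1+∣p-x∣ : ∀ (p : Subset N) x → ∣ p ∣ ≤ suc ∣ p - x ∣
∣p∣≤1+∣p-x∣ p x = ≤-trans (p⊆q⇒∣p∣≤∣q∣ p⊆p-x∪x) (∣p∪⁅x⁆∣≤1+∣p∣ (p - x) x)
  where
  p⊆p-x∪x : p ⊆ (p - x) ∪ ⁅ x ⁆
  p⊆p-x∪x {y} y∈p with y Fin.≟ x
  ... | yes refl = x∈p∪q⁺ (inj₂ (x∈⁅x⁆ x))
  ... | no y≢x = x∈p∪q⁺ (inj₁ (x∈p∧x≢y⇒x∈p-y y∈p y≢x))

nonempty : ∀ {N} (p : Subset N) → 0 < ∣ p ∣ → Nonempty p
nonempty {N} p 0<∣p∣ with nonempty? p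
... | yes p≢∅ = p≢∅
... | no p≡∅ = contradiction (trans (cong ∣_∣ (Empty-unique p≡∅)) (∣⊥∣≡0 N)) (>⇒≢ 0<∣p∣)

module _ {A : Set} {x y z : A} (x≢y : x ≢ y) (x≢z : x ≢ z) (y≢z : y ≢ z) where

  lookup-distinct-injective : ∀ {s t} → lookup (x ∷ y ∷ z ∷ []) s ≡ lookup (x ∷ y ∷ z ∷ []) t → s ≡ t
  lookup-distinct-injective {0F} {0F} _ = refl
  lookup-distinct-injective {0F} {1F} x≡y = contradiction x≡y x≢y
  lookup-distinct-injective {0F} {2F} x≡z = contradiction x≡z x≢z
  lookup-distinct-injective {1F} {0F} y≡x = contradiction (sym y≡x) x≢y
  lookup-distinct-injective {1F} {1F} _ = refl
  lookup-distinct-injective {1F} {2F} y≡z = contradiction y≡z y≢z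
  lookup-distinct-injective {2F} {0F} z≡x = contradiction (sym z≡x) x≢z
  lookup-distinct-injective {2F} {1F} z≡y = contradiction (sym z≡y) y≢z
  lookup-distinct-injective {2F} {2F} _ = refl

-- Families of edges that are blue for almost all of W

red? : ∀ col → Dec (col ≡ red)
red? red = yes refl
red? blue = no λ ()

≢red⇒≡blue : ∀ {col} → col ≢ red → col ≡ blue
≢red⇒≡blue {red} col≢red = contradiction refl col≢red
≢red⇒≡blue {blue} _ = refl

module _ {N : ℕ} (c : Colouring N) (W : Subset N) where

  AlmostBlue : (Fin N → Subset N) → Set
  AlmostBlue F = Σ[ W₁ ∈ Subset N ] W₁ ⊆ W × ∣ W ∣ ∸ 2 ≤ ∣ W₁ ∣ × (∀ x → x ∈ W₁ → c (F x) ≡ blue)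

  AlmostBlue-resp : ∀ {F G : Fin N → Subset N} → (∀ x → F x ≡ G x) → AlmostBlue F → AlmostBlue G
  AlmostBlue-resp F≗G (W₁ , W₁⊆W , ∣W₁∣ , F-blue) =
    W₁ , W₁⊆W , ∣W₁∣ , λ x x∈W₁ → trans (cong c (sym (F≗G x))) (F-blue x x∈W₁)

  blue-or-red-on : ∀ (F : Fin N → Subset N) U → (∀ x → x ∈ U → c (F x) ≡ blue) ⊎ ∃ λ x → x ∈ U × c (F x) ≡ red
  blue-or-red-on F U with any? (λ x → (x ∈? U) ×-dec red? (c (F x)))
  ... | yes red-witness = inj₂ red-witness
  ... | no no-red = inj₁ λ x x∈U → ≢red⇒≡blue λ Fx-red → no-red (x , x∈U , Fx-red)

  ∣W∣∸2≤∣W-x∣∸1 : ∀ {x} → ∣ W ∣ ∸ 2 ≤ ∣ W - x ∣ ∸ 1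
  ∣W∣∸2≤∣W-x∣∸1 {x} = ∸-monoˡ-≤ 2 (∣p∣≤1+∣p-x∣ W x)

  one-of-three-almost-blue : ∀ (F₁ F₂ F₃ : Fin N → Subset N) →
    (∀ x y z → x ∈ W → y ∈ W → z ∈ W → x ≢ y → x ≢ z → y ≢ z →
       c (F₁ x) ≡ red → c (F₂ y) ≡ red → c (F₃ z) ≡ red → ⊥) →
    AlmostBlue F₁ ⊎ AlmostBlue F₂ ⊎ AlmostBlue F₃
  one-of-three-almost-blue F₁ F₂ F₃ no-red-triple with blue-or-red-on F₁ W
  ... | inj₁ blue₁ = inj₁ (W , (λ x∈W → x∈W) , m∸n≤m ∣ W ∣ 2 , blue₁)
  ... | inj₂ (x , x∈W , red₁) with blue-or-red-on F₂ (W - x)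
  ...   | inj₁ blue₂ = inj₂ (inj₁ (W - x , p-x⊆p , ≤-trans ∣W∣∸2≤∣W-x∣∸1 (m∸n≤m _ 1) , blue₂))
  ...   | inj₂ (y , y∈W-x , red₂) with blue-or-red-on F₃ (W - x - y)
  ...     | inj₁ blue₃ =
    inj₂ (inj₂ (W - x - y , p-x⊆p ∘ p-x⊆p , ≤-trans ∣W∣∸2≤∣W-x∣∸1 (∸-monoˡ-≤ 1 (∣p∣≤1+∣p-x∣ (W - x) y)) , blue₃))
  ...     | inj₂ (z , z∈W-x-y , red₃) =
    ⊥-elim (no-red-triple x y z x∈W (p-x⊆p y∈W-x) (p-x⊆p (p-x⊆p z∈W-x-y))
      (≢-sym (x∈p-y⇒x≢y y∈W-x)) (≢-sym (x∈p-y⇒x≢y (p-x⊆p z∈W-x-y))) (≢-sym (x∈p-y⇒x≢y z∈W-x-y))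
      red₁ red₂ red₃)

-- Rerouting two consecutive edges through three new vertices

below-or-above : ∀ J k → k ≤ J ⊎ ∃ λ d → k ≡ J + suc d
below-or-above J k with k ≤? J
... | yes k≤J = inj₁ k≤J
... | no k≰J = inj₂ (k ∸ suc J , sym (trans (+-suc J _) (m+[n∸m]≡n (≰⇒> k≰J))))

edge-at : ∀ {N} (u : ℕ → Fin N) i K s → 3 * i ≡ K + s →
          edge u i ≡ quad (u (K + s)) (u (K + (s + 1))) (u (K + (s + 2))) (u (K + (s + 3)))
edge-at u i K s 3i≡K+s rewrite 3i≡K+s =
  quad-cong refl (cong u (+-assoc K s 1)) (cong u (+-assoc K s 2)) (cong u (+-assoc K s 3))

3j+6≤3n : ∀ {j n} → suc j < n → 3 * j + 6 ≤ 3 * n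
3j+6≤3n {j} {n} j+1<n = subst (_≤ 3 * n) (3[2+j]≡3j+6 j) (*-monoʳ-≤ 3 j+1<n)
  where
  3[2+j]≡3j+6 : ∀ j → 3 * suc (suc j) ≡ 3 * j + 6
  3[2+j]≡3j+6 = solve-∀

-- With J = 3 * j and pₖ = v (J + k), the path w follows v up to position J, then visits
-- p₀ p₍₁₊π₀₎ z₀ p₍₁₊π₁₎ p₍₁₊π₂₎ z₁ p₍₁₊π₃₎ p₍₁₊π₄₎ z₂ p₆ and then follows v shifted by three
-- positions.  reindex sends each position to the vertex it carries, old vertices by their position
-- on v; its inverse unindex gives both the injectivity and the vertex set of w.
module Reroute {N : ℕ} (W : Subset N) (n : ℕ) (v : ℕ → Fin N)
  (isLP : IsLoosePath n v) (v∉W : ∀ k → k ≤ 3 * n → v k ∉ W) (j : ℕ) (j+1<n : suc j < n)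
  (π : Permutation′ 5) (z : Fin 3 → Fin N) (z∈W : ∀ t → z t ∈ W) (z-injective : ∀ {s t} → z s ≡ z t → s ≡ t)
  where

  J : ℕ
  J = 3 * j

  data Index : Set where
    old : ℕ → Index
    new : Fin 3 → Index

  moved : Fin 5 → ℕ
  moved i = J + suc (toℕ (π ⟨$⟩ʳ i))

  oldSlot : Fin 5 → ℕ
  oldSlot 0F = 1
  oldSlot 1F = 3
  oldSlot 2F = 4
  oldSlot 3F = 6
  oldSlot 4F = 7

  newSlot : Fin 3 → ℕ
  newSlot 0F = 2
  newSlot 1F = 5
  newSlot 2F = 8

  windowAt : ℕ → Index
  windowAt 0 = old (moved 0F)
  windowAt 1 = new 0F
  windowAt 2 = old (moved 1F)
  windowAt 3 = old (moved 2F)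
  windowAt 4 = new 1F
  windowAt 5 = old (moved 3F)
  windowAt 6 = old (moved 4F)
  windowAt 7 = new 2F
  windowAt (suc (suc (suc (suc (suc (suc (suc (suc m)))))))) = old (J + (6 + m))

  reindex : ℕ → Index
  reindex k = at (k ∸ J)
    where
    at : ℕ → Index
    at zero = old k
    at (suc d) = windowAt d

  slotOf : ℕ → ℕ
  slotOf 0 = J + oldSlot (π ⟨$⟩ˡ 0F)
  slotOf 1 = J + oldSlot (π ⟨$⟩ˡ 1F)
  slotOf 2 = J + oldSlot (π ⟨$⟩ˡ 2F)
  slotOf 3 = J + oldSlot (π ⟨$⟩ˡ 3F)
  slotOf 4 = J + oldSlot (π ⟨$⟩ˡ 4F)
  slotOf (suc (suc (suc (suc (suc m))))) = J + (9 + m)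

  unindex : Index → ℕ
  unindex (old i) = at (i ∸ J)
    where
    at : ℕ → ℕ
    at zero = i
    at (suc o) = slotOf o
  unindex (new t) = J + newSlot t

  val : Index → Fin N
  val (old i) = v i
  val (new t) = z t

  w : ℕ → Fin N
  w = val ∘ reindex

  reindex-below : ∀ {k} → k ≤ J → reindex k ≡ old k
  reindex-below {k} k≤J rewrite m≤n⇒m∸n≡0 k≤J = refl

  reindex-above : ∀ d → reindex (J + suc d) ≡ windowAt d
  reindex-above d rewrite m+n∸m≡n J (suc d) = refl

  unindex-below : ∀ {i} → i ≤ J → unindex (old i) ≡ i
  unindex-below {i} i≤J rewrite m≤n⇒m∸n≡0 i≤J = refl

  unindex-above : ∀ o → unindex (old (J + suc o)) ≡ slotOf o
  unindex-above o rewrite m+n∸m≡n J (suc o) = refl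

  slotOf-toℕ : ∀ f → slotOf (toℕ f) ≡ J + oldSlot (π ⟨$⟩ˡ f)
  slotOf-toℕ 0F = refl
  slotOf-toℕ 1F = refl
  slotOf-toℕ 2F = refl
  slotOf-toℕ 3F = refl
  slotOf-toℕ 4F = refl

  unindex-moved : ∀ i → unindex (old (moved i)) ≡ J + oldSlot i
  unindex-moved i = begin
    unindex (old (moved i))               ≡⟨ unindex-above (toℕ (π ⟨$⟩ʳ i)) ⟩
    slotOf (toℕ (π ⟨$⟩ʳ i))               ≡⟨ slotOf-toℕ (π ⟨$⟩ʳ i) ⟩
    J + oldSlot (π ⟨$⟩ˡ (π ⟨$⟩ʳ i))       ≡⟨ cong (λ s → J + oldSlot s) (inverseˡ π) ⟩
    J + oldSlot i                         ∎
    where open ≡-Reasoning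

  reindex-oldSlot : ∀ i → reindex (J + oldSlot i) ≡ old (moved i)
  reindex-oldSlot 0F = reindex-above 0
  reindex-oldSlot 1F = reindex-above 2
  reindex-oldSlot 2F = reindex-above 3
  reindex-oldSlot 3F = reindex-above 5
  reindex-oldSlot 4F = reindex-above 6

  reindex-newSlot : ∀ t → reindex (J + newSlot t) ≡ new t
  reindex-newSlot 0F = reindex-above 1
  reindex-newSlot 1F = reindex-above 4
  reindex-newSlot 2F = reindex-above 7

  unindex-windowAt : ∀ d → unindex (windowAt d) ≡ J + suc d
  unindex-windowAt 0 = unindex-moved 0F
  unindex-windowAt 1 = refl
  unindex-windowAt 2 = unindex-moved 1F
  unindex-windowAt 3 = unindex-moved 2F
  unindex-windowAt 4 = refl
  unindex-windowAt 5 = unindex-moved 3F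
  unindex-windowAt 6 = unindex-moved 4F
  unindex-windowAt 7 = refl
  unindex-windowAt (suc (suc (suc (suc (suc (suc (suc (suc m)))))))) = unindex-above (5 + m)

  unindex-reindex : ∀ k → unindex (reindex k) ≡ k
  unindex-reindex k with below-or-above J k
  ... | inj₁ k≤J = trans (cong unindex (reindex-below k≤J)) (unindex-below k≤J)
  ... | inj₂ (d , refl) = trans (cong unindex (reindex-above d)) (unindex-windowAt d)

  reindex-slotOf : ∀ f → reindex (slotOf (toℕ f)) ≡ old (J + suc (toℕ f))
  reindex-slotOf f = begin
    reindex (slotOf (toℕ f))              ≡⟨ cong reindex (slotOf-toℕ f) ⟩
    reindex (J + oldSlot (π ⟨$⟩ˡ f))      ≡⟨ reindex-oldSlot (π ⟨$⟩ˡ f) ⟩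
    old (moved (π ⟨$⟩ˡ f))                ≡⟨ cong (λ g → old (J + suc (toℕ g))) (inverseʳ π) ⟩
    old (J + suc (toℕ f))                 ∎
    where open ≡-Reasoning

  reindex-unindex : ∀ κ → reindex (unindex κ) ≡ κ
  reindex-unindex (new t) = reindex-newSlot t
  reindex-unindex (old i) with below-or-above J i
  ... | inj₁ i≤J = trans (cong reindex (unindex-below i≤J)) (reindex-below i≤J)
  ... | inj₂ (o , refl) = trans (cong reindex (unindex-above o)) (at o)
    where
    at : ∀ o → reindex (slotOf o) ≡ old (J + suc o)
    at 0 = reindex-slotOf 0F
    at 1 = reindex-slotOf 1F
    at 2 = reindex-slotOf 2F
    at 3 = reindex-slotOf 3F
    at 4 = reindex-slotOf 4F
    at (suc (suc (suc (suc (suc m))))) = reindex-above (8 + m)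

  Valid : Index → Set
  Valid (old i) = i ≤ 3 * n
  Valid (new _) = ⊤

  J+6≤3n : J + 6 ≤ 3 * n
  J+6≤3n = 3j+6≤3n j+1<n

  3[1+n]≡3+3n : 3 * suc n ≡ 3 + 3 * n
  3[1+n]≡3+3n = *-suc 3 n

  window-bound : ∀ {d} → d ≤ 8 → J + d ≤ 3 * suc n
  window-bound {d} d≤8 = begin
    J + d        ≤⟨ +-monoʳ-≤ J d≤8 ⟩
    J + (6 + 2)  ≡⟨ +-assoc J 6 2 ⟨
    J + 6 + 2    ≤⟨ +-mono-≤ J+6≤3n (n≤1+n 2) ⟩
    3 * n + 3    ≡⟨ +-comm (3 * n) 3 ⟩
    3 + 3 * n    ≡⟨ 3[1+n]≡3+3n ⟨
    3 * suc n    ∎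
    where open ≤-Reasoning

  tail-shift : ∀ m → J + (9 + m) ≡ 3 + (J + (6 + m))
  tail-shift = shift j
    where
    shift : ∀ j m → 3 * j + (9 + m) ≡ 3 + (3 * j + (6 + m))
    shift = solve-∀

  tail-valid : ∀ m → J + (9 + m) ≤ 3 * suc n → J + (6 + m) ≤ 3 * n
  tail-valid m h = +-cancelˡ-≤ 3 _ _ (subst₂ _≤_ (tail-shift m) 3[1+n]≡3+3n h)

  tail-bound : ∀ m → J + (6 + m) ≤ 3 * n → J + (9 + m) ≤ 3 * suc n
  tail-bound m h = subst₂ _≤_ (sym (tail-shift m)) (sym 3[1+n]≡3+3n) (+-monoʳ-≤ 3 h)

  moved-valid : ∀ i → moved i ≤ 3 * n
  moved-valid i = ≤-trans (+-monoʳ-≤ J (≤-trans (toℕ<n (π ⟨$⟩ʳ i)) (n≤1+n 5))) J+6≤3n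

  windowAt-valid : ∀ d → J + suc d ≤ 3 * suc n → Valid (windowAt d)
  windowAt-valid 0 _ = moved-valid 0F
  windowAt-valid 1 _ = tt
  windowAt-valid 2 _ = moved-valid 1F
  windowAt-valid 3 _ = moved-valid 2F
  windowAt-valid 4 _ = tt
  windowAt-valid 5 _ = moved-valid 3F
  windowAt-valid 6 _ = moved-valid 4F
  windowAt-valid 7 _ = tt
  windowAt-valid (suc (suc (suc (suc (suc (suc (suc (suc m)))))))) h = tail-valid m h

  reindex-valid : ∀ k → k ≤ 3 * suc n → Valid (reindex k)
  reindex-valid k k≤ with below-or-above J k
  ... | inj₁ k≤J = subst Valid (sym (reindex-below k≤J)) (≤-trans k≤J (≤-trans (m≤m+n J 6) J+6≤3n))
  ... | inj₂ (d , refl) = subst Valid (sym (reindex-above d)) (windowAt-valid d k≤)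

  oldSlot≤8 : ∀ i → oldSlot i ≤ 8
  oldSlot≤8 0F = ≤ᵇ⇒≤ 1 8 tt
  oldSlot≤8 1F = ≤ᵇ⇒≤ 3 8 tt
  oldSlot≤8 2F = ≤ᵇ⇒≤ 4 8 tt
  oldSlot≤8 3F = ≤ᵇ⇒≤ 6 8 tt
  oldSlot≤8 4F = ≤ᵇ⇒≤ 7 8 tt

  newSlot≤8 : ∀ t → newSlot t ≤ 8
  newSlot≤8 0F = ≤ᵇ⇒≤ 2 8 tt
  newSlot≤8 1F = ≤ᵇ⇒≤ 5 8 tt
  newSlot≤8 2F = ≤-refl

  unindex-bound : ∀ κ → Valid κ → unindex κ ≤ 3 * suc n
  unindex-bound (new t) _ = window-bound (newSlot≤8 t)
  unindex-bound (old i) i≤3n with below-or-above J i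
  ... | inj₁ i≤J = subst (_≤ 3 * suc n) (sym (unindex-below i≤J)) (≤-trans i≤3n (*-monoʳ-≤ 3 (n≤1+n n)))
  ... | inj₂ (o , refl) = subst (_≤ 3 * suc n) (sym (unindex-above o)) (at o i≤3n)
    where
    at : ∀ o → J + suc o ≤ 3 * n → slotOf o ≤ 3 * suc n
    at 0 _ = window-bound (oldSlot≤8 (π ⟨$⟩ˡ 0F))
    at 1 _ = window-bound (oldSlot≤8 (π ⟨$⟩ˡ 1F))
    at 2 _ = window-bound (oldSlot≤8 (π ⟨$⟩ˡ 2F))
    at 3 _ = window-bound (oldSlot≤8 (π ⟨$⟩ˡ 3F))
    at 4 _ = window-bound (oldSlot≤8 (π ⟨$⟩ˡ 4F))
    at (suc (suc (suc (suc (suc m))))) h = tail-bound m h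

  val-injective : ∀ {κ λ′} → Valid κ → Valid λ′ → val κ ≡ val λ′ → κ ≡ λ′
  val-injective {old i} {old i′} i≤ i′≤ eq = cong old (isLP i i′ i≤ i′≤ eq)
  val-injective {old i} {new t} i≤ _ eq = contradiction (subst (_∈ W) (sym eq) (z∈W t)) (v∉W i i≤)
  val-injective {new t} {old i} _ i≤ eq = contradiction (subst (_∈ W) eq (z∈W t)) (v∉W i i≤)
  val-injective {new t} {new t′} _ _ eq = cong new (z-injective eq)

  w-isLoosePath : IsLoosePath (suc n) w
  w-isLoosePath k l k≤ l≤ wk≡wl = begin
    k                      ≡⟨ unindex-reindex k ⟨
    unindex (reindex k)    ≡⟨ cong unindex (val-injective (reindex-valid k k≤) (reindex-valid l l≤) wk≡wl) ⟩
    unindex (reindex l)    ≡⟨ unindex-reindex l ⟩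
    l                      ∎
    where open ≡-Reasoning

  new-vertices : Subset N
  new-vertices = ⁅ z 0F ⁆ ∪ (⁅ z 1F ⁆ ∪ ⁅ z 2F ⁆)

  ∈-new-vertices⁻ : ∀ {u} → u ∈ new-vertices → ∃ λ t → z t ≡ u
  ∈-new-vertices⁻ u∈ with x∈p∪q⁻ ⁅ z 0F ⁆ _ u∈
  ... | inj₁ u∈₀ = 0F , sym (x∈⁅y⁆⇒x≡y _ u∈₀)
  ... | inj₂ u∈₁₂ with x∈p∪q⁻ ⁅ z 1F ⁆ _ u∈₁₂
  ...   | inj₁ u∈₁ = 1F , sym (x∈⁅y⁆⇒x≡y _ u∈₁)
  ...   | inj₂ u∈₂ = 2F , sym (x∈⁅y⁆⇒x≡y _ u∈₂)

  ∈-new-vertices⁺ : ∀ t → z t ∈ new-vertices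
  ∈-new-vertices⁺ 0F = x∈p∪q⁺ (inj₁ (x∈⁅x⁆ _))
  ∈-new-vertices⁺ 1F = x∈p∪q⁺ (inj₂ (x∈p∪q⁺ (inj₁ (x∈⁅x⁆ _))))
  ∈-new-vertices⁺ 2F = x∈p∪q⁺ (inj₂ (x∈p∪q⁺ (inj₂ (x∈⁅x⁆ _))))

  new-vertices⊆W : new-vertices ⊆ W
  new-vertices⊆W u∈ with ∈-new-vertices⁻ u∈
  ... | t , refl = z∈W t

  w-vertices : ∀ u → InPath (suc n) w u ⇔ (InPath n v u ⊎ u ∈ new-vertices)
  w-vertices u = mk⇔ to from
    where
    to : InPath (suc n) w u → InPath n v u ⊎ u ∈ new-vertices
    to (k , k≤ , eq) with reindex k | reindex-valid k k≤
    ... | old i | i≤ = inj₁ (i , i≤ , eq)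
    ... | new t | _ = inj₂ (subst (_∈ new-vertices) eq (∈-new-vertices⁺ t))
    at : ∀ κ → Valid κ → val κ ≡ u → InPath (suc n) w u
    at κ valid eq = unindex κ , unindex-bound κ valid , trans (cong val (reindex-unindex κ)) eq
    from : InPath n v u ⊎ u ∈ new-vertices → InPath (suc n) w u
    from (inj₁ (i , i≤ , eq)) = at (old i) i≤ eq
    from (inj₂ u∈) with ∈-new-vertices⁻ u∈
    ... | t , eq = at (new t) tt eq

  w-below : ∀ {k} → k ≤ J → w k ≡ v k
  w-below k≤J = cong val (reindex-below k≤J)

  w-above : ∀ d → w (J + suc d) ≡ val (windowAt d)
  w-above d = cong val (reindex-above d)

  edge-w-before : ∀ {i} → i < j → edge w i ≡ edge v i
  edge-w-before {i} i<j =
    quad-cong (w-below (≤-trans (m≤m+n (3 * i) 3) 3i+3≤J)) (w-below (at (s≤s z≤n)))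
              (w-below (at (s≤s (s≤s z≤n)))) (w-below 3i+3≤J)
    where
    3i+3≤J : 3 * i + 3 ≤ J
    3i+3≤J = subst (_≤ J) (trans (*-suc 3 i) (+-comm 3 (3 * i))) (*-monoʳ-≤ 3 i<j)
    at : ∀ {t} → t ≤ 3 → 3 * i + t ≤ J
    at t≤3 = ≤-trans (+-monoʳ-≤ (3 * i) t≤3) 3i+3≤J

  edge-w-first : edge w j ≡ quad (v J) (v (moved 0F)) (z 0F) (v (moved 1F))
  edge-w-first = quad-cong (w-below ≤-refl) (w-above 0) (w-above 1) (w-above 2)

  edge-w-second : edge w (suc j) ≡ quad (v (moved 1F)) (v (moved 2F)) (z 1F) (v (moved 3F))
  edge-w-second = trans (edge-at w (suc j) J 3 (trans (*-suc 3 j) (+-comm 3 J)))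
                        (quad-cong (w-above 2) (w-above 3) (w-above 4) (w-above 5))

  edge-w-third : edge w (suc (suc j)) ≡ quad (v (moved 3F)) (v (moved 4F)) (z 2F) (v (J + 6))
  edge-w-third = trans (edge-at w (suc (suc j)) J 6 (arith j))
                       (quad-cong (w-above 5) (w-above 6) (w-above 7) (w-above 8))
    where
    arith : ∀ j → 3 * suc (suc j) ≡ 3 * j + 6
    arith = solve-∀

  edge-w-after : ∀ m → edge w (3 + (j + m)) ≡ edge v (2 + (j + m))
  edge-w-after m = begin
    edge w (3 + (j + m))
      ≡⟨ edge-at w (3 + (j + m)) J (9 + 3 * m) (arith₁ j m) ⟩
    quad (w (J + (9 + 3 * m))) (w (J + (9 + 3 * m + 1))) (w (J + (9 + 3 * m + 2))) (w (J + (9 + 3 * m + 3)))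
      ≡⟨ quad-cong (tail (3 * m)) (tail (3 * m + 1)) (tail (3 * m + 2)) (tail (3 * m + 3)) ⟩
    quad (v (J + (6 + 3 * m))) (v (J + (6 + 3 * m + 1))) (v (J + (6 + 3 * m + 2))) (v (J + (6 + 3 * m + 3)))
      ≡⟨ edge-at v (2 + (j + m)) J (6 + 3 * m) (arith₂ j m) ⟨
    edge v (2 + (j + m))
      ∎
    where
    open ≡-Reasoning
    tail : ∀ m → w (J + (9 + m)) ≡ v (J + (6 + m))
    tail m = w-above (8 + m)
    arith₁ : ∀ j m → 3 * (3 + (j + m)) ≡ 3 * j + (9 + 3 * m)
    arith₁ = solve-∀
    arith₂ : ∀ j m → 3 * (2 + (j + m)) ≡ 3 * j + (6 + 3 * m)
    arith₂ = solve-∀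

  module _ (c : Colouring N) (mono : Monochromatic c red n v)
    (red₀ : c (quad (v J) (v (moved 0F)) (z 0F) (v (moved 1F))) ≡ red)
    (red₁ : c (quad (v (moved 1F)) (v (moved 2F)) (z 1F) (v (moved 3F))) ≡ red)
    (red₂ : c (quad (v (moved 3F)) (v (moved 4F)) (z 2F) (v (J + 6))) ≡ red)
    where

    w-monochromatic : Monochromatic c red (suc n) w
    w-monochromatic i i<1+n with i <? j
    ... | yes i<j = trans (cong c (edge-w-before i<j)) (mono i (<-trans i<j (<-trans (n<1+n j) j+1<n)))
    ... | no i≮j = subst (λ i → c (edge w i) ≡ red) i∸j+j≡i (from-j (i ∸ j) (subst (_< suc n) (sym i∸j+j≡i) i<1+n))
      where
      i∸j+j≡i : i ∸ j + j ≡ i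
      i∸j+j≡i = m∸n+n≡m (≮⇒≥ i≮j)
      from-j : ∀ d → d + j < suc n → c (edge w (d + j)) ≡ red
      from-j 0 _ = trans (cong c edge-w-first) red₀
      from-j 1 _ = trans (cong c edge-w-second) red₁
      from-j 2 _ = trans (cong c edge-w-third) red₂
      from-j (suc (suc (suc m))) h rewrite +-comm m j =
        trans (cong c (edge-w-after m)) (mono (2 + (j + m)) (s≤s⁻¹ h))

    w-extends : IsExtension c red W n v j 2 w
    w-extends =
      new-vertices , new-vertices⊆W , s≤s z≤n , ≤-trans (s≤s (s≤s z≤n)) j+1<n , subst (_≤ n) (+-comm 2 j) j+1<n ,
      w-isLoosePath , w-monochromatic , (λ i i<j → edge-w-before i<j) , after , w-vertices ,
      (λ _ → w-below z≤n) , last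
      where
      after : ∀ i → j + 2 < i → i ≤ n → edge w i ≡ edge v (i ∸ 1)
      after i j+2<i _ with m+[n∸m]≡n {3 + j} {i} (subst (λ k → suc k ≤ i) (+-comm j 2) j+2<i)
      ... | eq rewrite sym eq = edge-w-after (i ∸ (3 + j))
      last : j + 2 ≡ n → w (3 * suc n) ≡ v (3 * n)
      last j+2≡n = subst (λ n → w (3 * suc n) ≡ v (3 * n)) j+2≡n
        (trans (cong w (arith₁ j)) (trans (w-above 8) (cong v (sym (arith₂ j)))))
        where
        arith₁ : ∀ j → 3 * suc (j + 2) ≡ 3 * j + 9
        arith₁ = solve-∀
        arith₂ : ∀ j → 3 * (j + 2) ≡ 3 * j + 6
        arith₂ = solve-∀

-- Blue configurations inside two consecutive edges

RobustBlueGoodConfig : ∀ {N} → Colouring N → Subset N → (ℕ → Fin N) → ℕ → Set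
RobustBlueGoodConfig {N} c W v j =
  ∃ λ x → ∃ λ a1 → ∃ λ a2 → ∃ λ a3 → ∃ λ a4 → ∃ λ a5 → ∃ λ y →
    BlueGoodConfig c W v j x a1 a2 a3 a4 a5 y
    × (Σ (Subset N) λ W₁ → Σ (Subset N) λ W₂ →
         W₁ ⊆ W × W₂ ⊆ W × ∣ W ∣ ∸ 2 ≤ ∣ W₁ ∣ × ∣ W ∣ ∸ 3 ≤ ∣ W₂ ∣
         × (∀ x′ y′ → x′ ∈ W₁ → y′ ∈ W₂ → x′ ≢ y′ → BlueGoodConfig c W v j x′ a1 a2 a3 a4 a5 y′))

tabulated-permutation : (σ σ⁻¹ : Vec (Fin 5) 5) →
  {σσ⁻¹ : True (all? λ i → lookup σ (lookup σ⁻¹ i) Fin.≟ i)} →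
  {σ⁻¹σ : True (all? λ i → lookup σ⁻¹ (lookup σ i) Fin.≟ i)} → Permutation′ 5
tabulated-permutation σ σ⁻¹ {σσ⁻¹} {σ⁻¹σ} = permutation (lookup σ) (lookup σ⁻¹) (toWitness σσ⁻¹) (toWitness σ⁻¹σ)

-- The new edges are p₀p₂xp₄, p₄p₅yp₁, p₁p₃zp₆ for rerouting₀, p₀p₁xp₂, p₂p₅yp₃, p₃p₄zp₆ for
-- rerouting₁ and p₀p₄xp₃, p₃p₅yp₂, p₂p₁zp₆ for rerouting₂.
rerouting₀ rerouting₁ rerouting₂ : Permutation′ 5
rerouting₀ = tabulated-permutation (1F ∷ 3F ∷ 4F ∷ 0F ∷ 2F ∷ []) (3F ∷ 0F ∷ 4F ∷ 1F ∷ 2F ∷ [])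
rerouting₁ = tabulated-permutation (0F ∷ 1F ∷ 4F ∷ 2F ∷ 3F ∷ []) (0F ∷ 1F ∷ 3F ∷ 4F ∷ 2F ∷ [])
rerouting₂ = tabulated-permutation (3F ∷ 2F ∷ 4F ∷ 1F ∷ 0F ∷ []) (4F ∷ 3F ∷ 1F ∷ 0F ∷ 2F ∷ [])

module Segment {N : ℕ} (c : Colouring N) (W : Subset N) (n : ℕ) (v : ℕ → Fin N)
  (isLP : IsLoosePath n v) (mono : Monochromatic c red n v) (v∉W : ∀ k → k ≤ 3 * n → v k ∉ W)
  (4≤∣W∣ : 4 ≤ ∣ W ∣) (maximal : Maximal c red W n v) (j : ℕ) (j+1<n : suc j < n)
  where

  J : ℕ
  J = 3 * j

  -- p 0F is v J rather than v (J + 0), so that edge v j is quad (p 0F) (p 1F) (p 2F) (p 3F) by definition.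
  p : Fin 7 → Fin N
  p zero = v J
  p (suc k) = v (J + suc (toℕ k))

  p≡v : ∀ k → p k ≡ v (J + toℕ k)
  p≡v zero = cong v (sym (+-identityʳ J))
  p≡v (suc k) = refl

  J+k≤3n : ∀ (k : Fin 7) → J + toℕ k ≤ 3 * n
  J+k≤3n k = ≤-trans (+-monoʳ-≤ J (toℕ≤pred[n] k)) (3j+6≤3n j+1<n)

  p-injective : ∀ {a b} → p a ≡ p b → a ≡ b
  p-injective {a} {b} pa≡pb =
    toℕ-injective (+-cancelˡ-≡ J _ _ (isLP _ _ (J+k≤3n a) (J+k≤3n b) (trans (sym (p≡v a)) (trans pa≡pb (p≡v b)))))

  p∉W : ∀ k → p k ∉ W
  p∉W k pk∈W = v∉W _ (J+k≤3n k) (subst (_∈ W) (p≡v k) pk∈W)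

  second-edge : edge v (suc j) ≡ quad (p 3F) (p 4F) (p 5F) (p 6F)
  second-edge = edge-at v (suc j) J 3 (trans (*-suc 3 j) (+-comm 3 J))

  -- A record rather than a definition, so that the indices can be recovered by unification.
  record BlueTriple (a b d : Fin 7) : Set where
    constructor blue-triple
    field almost-blue : AlmostBlue c W (λ X → quad X (p a) (p b) (p d))

  moved-index : Permutation′ 5 → Fin 5 → Fin 7
  moved-index π i = suc (inject₁ (π ⟨$⟩ʳ i))

  rerouting-almost-blue : ∀ π → let s = moved-index π in
    BlueTriple 0F (s 0F) (s 1F) ⊎ BlueTriple (s 1F) (s 2F) (s 3F) ⊎ BlueTriple (s 3F) (s 4F) 6F
  rerouting-almost-blue π = Sum.map blue-triple (Sum.map blue-triple blue-triple) $
    one-of-three-almost-blue c W (λ X → quad X (p 0F) (p (s 0F)) (p (s 1F)))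
      (λ X → quad X (p (s 1F)) (p (s 2F)) (p (s 3F))) (λ X → quad X (p (s 3F)) (p (s 4F)) (p 6F)) no-red-rerouting
    where
    s = moved-index π
    p-s : ∀ i → p (s i) ≡ v (J + suc (toℕ (π ⟨$⟩ʳ i)))
    p-s i = cong (λ t → v (J + suc t)) (toℕ-inject₁ (π ⟨$⟩ʳ i))
    unpull : ∀ {x a b d a′ b′ d′} → a ≡ a′ → b ≡ b′ → d ≡ d′ → c (quad x a b d) ≡ red → c (quad a′ b′ x d′) ≡ red
    unpull refl refl refl isRed = trans (cong c (quad-pull₃ _ _ _ _)) isRed
    no-red-rerouting : ∀ x y z → x ∈ W → y ∈ W → z ∈ W → x ≢ y → x ≢ z → y ≢ z →
      c (quad x (p 0F) (p (s 0F)) (p (s 1F))) ≡ red → c (quad y (p (s 1F)) (p (s 2F)) (p (s 3F))) ≡ red →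
      c (quad z (p (s 3F)) (p (s 4F)) (p 6F)) ≡ red → ⊥
    no-red-rerouting x y z x∈W y∈W z∈W x≢y x≢z y≢z red₀ red₁ red₂ =
      maximal (j , 2 , w , w-extends c mono (unpull refl (p-s 0F) (p-s 1F) red₀)
                                             (unpull (p-s 1F) (p-s 2F) (p-s 3F) red₁)
                                             (unpull (p-s 3F) (p-s 4F) refl red₂))
      where
      xyz∈W : ∀ t → lookup (x ∷ y ∷ z ∷ []) t ∈ W
      xyz∈W 0F = x∈W
      xyz∈W 1F = y∈W
      xyz∈W 2F = z∈W
      open Reroute W n v isLP v∉W j j+1<n π (lookup (x ∷ y ∷ z ∷ [])) xyz∈W (lookup-distinct-injective x≢y x≢z y≢z)

  2≤∣W∣∸2 : 2 ≤ ∣ W ∣ ∸ 2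
  2≤∣W∣∸2 = ∸-monoˡ-≤ 2 4≤∣W∣

  first-indices second-indices : List (Fin 7)
  first-indices = 0F ∷ 1F ∷ 2F ∷ 3F ∷ []
  second-indices = 3F ∷ 4F ∷ 5F ∷ 6F ∷ []

  p-∈-map⁻ : ∀ {d ks} → p d ∈ₗ map p ks → d ∈ₗ ks
  p-∈-map⁻ pd∈ with ∈-map⁻ p pd∈
  ... | k , k∈ks , pd≡pk = subst (_∈ₗ _) (sym (p-injective pd≡pk)) k∈ks

  ∈-first-edge : ∀ {k} → k ∈ₗ first-indices → p k ∈ edge v j
  ∈-first-edge k∈ = ∈-quad⁺ (∈-map⁺ p k∈)

  ∈-second-edge : ∀ {k} → k ∈ₗ second-indices → p k ∈ edge v (suc j)
  ∈-second-edge {k} k∈ = subst (p k ∈_) (sym second-edge) (∈-quad⁺ (∈-map⁺ p k∈))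

  ∉-first-edge : ∀ {k} → k ∉ₗ first-indices → p k ∉ edge v j
  ∉-first-edge k∉ pk∈ = k∉ (p-∈-map⁻ (∈-quad⁻ pk∈))

  ∈-edges : ∀ k → p k ∈ edge v j ∪ edge v (suc j)
  ∈-edges 0F = x∈p∪q⁺ (inj₁ (∈-first-edge (here refl)))
  ∈-edges 1F = x∈p∪q⁺ (inj₁ (∈-first-edge (there (here refl))))
  ∈-edges 2F = x∈p∪q⁺ (inj₁ (∈-first-edge (there (there (here refl)))))
  ∈-edges 3F = x∈p∪q⁺ (inj₁ (∈-first-edge (there (there (there (here refl))))))
  ∈-edges 4F = x∈p∪q⁺ (inj₂ (∈-second-edge (there (here refl))))
  ∈-edges 5F = x∈p∪q⁺ (inj₂ (∈-second-edge (there (there (here refl)))))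
  ∈-edges 6F = x∈p∪q⁺ (inj₂ (∈-second-edge (there (there (there (here refl))))))

  module _ (a₁ a₂ a₃ a₄ a₅ : Fin 7) where

    as : List (Fin 7)
    as = a₁ ∷ a₂ ∷ a₃ ∷ a₄ ∷ a₅ ∷ []

    blue-good-config : Unique as → (∃ λ d → d ∈ₗ second-indices × d ∉ₗ first-indices × d ∉ₗ as) →
      ∀ x y → x ∈ W → y ∈ W → x ≢ y →
      c (quad x (p a₁) (p a₂) (p a₃)) ≡ blue → c (quad (p a₃) (p a₄) (p a₅) y) ≡ blue →
      BlueGoodConfig c W v j x (p a₁) (p a₂) (p a₃) (p a₄) (p a₅) y
    blue-good-config as-unique (d , d∈second , d∉first , d∉as) x y x∈W y∈W x≢y f-blue g-blue =
      unique , x∈W , y∈W , f-blue , g-blue , S⊆edges , (p d , ∈-second-edge d∈second , ∉-first-edge d∉first , d∉S)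
      where
      ∉-map-p : ∀ {u} → u ∈ W → u ∈ₗ map p as → ⊥
      ∉-map-p u∈W u∈ with ∈-map⁻ p {xs = as} u∈
      ... | k , _ , refl = p∉W k u∈W
      unique : Unique (x ∷ (map p as ++ y ∷ []))
      unique = ++⁺ (tabulate λ { u∈ refl → ∉-map-p x∈W u∈ }) (x≢y ∷ [])
             ∷ Unique.++⁺ (Unique.map⁺ p-injective as-unique) ([] ∷ []) λ { (y∈ , here refl) → ∉-map-p y∈W y∈ }
      S⊆edges : ⁅ p a₁ ⁆ ∪ quad (p a₂) (p a₃) (p a₄) (p a₅) ⊆ edge v j ∪ edge v (suc j)
      S⊆edges u∈S with ∈-map⁻ p {xs = as} (∈-⁅⁆∪quad⁻ u∈S)
      ... | k , _ , refl = ∈-edges k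
      d∉S : p d ∉ ⁅ p a₁ ⁆ ∪ quad (p a₂) (p a₃) (p a₄) (p a₅)
      d∉S pd∈S = d∉as (p-∈-map⁻ (∈-⁅⁆∪quad⁻ pd∈S))

    robust-config : Unique as → (∃ λ d → d ∈ₗ second-indices × d ∉ₗ first-indices × d ∉ₗ as) →
      BlueTriple a₁ a₂ a₃ → BlueTriple a₃ a₄ a₅ → RobustBlueGoodConfig c W v j
    robust-config as-unique good (blue-triple (W₁ , W₁⊆W , ∣W₁∣ , f-blue)) (blue-triple (W₂ , W₂⊆W , ∣W₂∣ , g-blue))
      with nonempty W₂ (≤-trans (n≤1+n 1) (≤-trans 2≤∣W∣∸2 ∣W₂∣))
    ... | y , y∈W₂ with nonempty (W₁ - y) (s≤s⁻¹ (≤-trans (≤-trans 2≤∣W∣∸2 ∣W₁∣) (∣p∣≤1+∣p-x∣ W₁ y)))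
    ... | x , x∈W₁-y =
      x , p a₁ , p a₂ , p a₃ , p a₄ , p a₅ , y ,
      config x y (p-x⊆p x∈W₁-y) y∈W₂ (x∈p-y⇒x≢y x∈W₁-y) ,
      W₁ , W₂ , W₁⊆W , W₂⊆W , ∣W₁∣ , ≤-trans (∸-monoʳ-≤ ∣ W ∣ (≤ᵇ⇒≤ 2 3 tt)) ∣W₂∣ , config
      where
      config : ∀ x y → x ∈ W₁ → y ∈ W₂ → x ≢ y → BlueGoodConfig c W v j x (p a₁) (p a₂) (p a₃) (p a₄) (p a₅) y
      config x y x∈W₁ y∈W₂ x≢y = blue-good-config as-unique good x y (W₁⊆W x∈W₁) (W₂⊆W y∈W₂) x≢y
        (f-blue x x∈W₁) (trans (cong c (quad-pull₄ (p a₃) (p a₄) (p a₅) y)) (g-blue y y∈W₂))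

  same-set? : (xs ys : List (Fin 7)) → Dec (xs ⊆ₗ ys × ys ⊆ₗ xs)
  same-set? xs ys = (xs ⊆? ys) ×-dec (ys ⊆? xs)

  BlueTriple-reorder : ∀ {a₁ a₂ a₃ b₁ b₂ b₃} →
    (a₁ ∷ a₂ ∷ a₃ ∷ []) ⊆ₗ (b₁ ∷ b₂ ∷ b₃ ∷ []) × (b₁ ∷ b₂ ∷ b₃ ∷ []) ⊆ₗ (a₁ ∷ a₂ ∷ a₃ ∷ []) →
    BlueTriple b₁ b₂ b₃ → BlueTriple a₁ a₂ a₃
  BlueTriple-reorder (as⊆bs , bs⊆as) (blue-triple B) = blue-triple $ AlmostBlue-resp c W (λ X →
    ⊆-antisym (quad⊆quad (∷⁺ʳ X (⊆-map⁺ p bs⊆as))) (quad⊆quad (∷⁺ʳ X (⊆-map⁺ p as⊆bs)))) B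

  -- At concrete indices the four side conditions normalise to ⊤ and are filled in automatically.
  configuration : ∀ {b₁ b₂ b₃ b₄ b₅ b₆} a₁ a₂ a₃ a₄ a₅ → BlueTriple b₁ b₂ b₃ → BlueTriple b₄ b₅ b₆ →
    {f-indices : True (same-set? (a₁ ∷ a₂ ∷ a₃ ∷ []) (b₁ ∷ b₂ ∷ b₃ ∷ []))} →
    {g-indices : True (same-set? (a₃ ∷ a₄ ∷ a₅ ∷ []) (b₄ ∷ b₅ ∷ b₆ ∷ []))} →
    {distinct : True (unique? (as a₁ a₂ a₃ a₄ a₅))} →
    {good : True (Any.any? (λ d → (d ∉? first-indices) ×-dec (d ∉? as a₁ a₂ a₃ a₄ a₅)) second-indices)} →
    RobustBlueGoodConfig c W v j
  configuration a₁ a₂ a₃ a₄ a₅ f g {f-indices} {g-indices} {distinct} {good} =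
    robust-config a₁ a₂ a₃ a₄ a₅ (toWitness distinct) (find (toWitness good))
      (BlueTriple-reorder (toWitness f-indices) f) (BlueTriple-reorder (toWitness g-indices) g)

  -- B₀₂₄ says that the edges {X, p₀, p₂, p₄} are blue for almost all X ∈ W.  The triple {2,3,5} of
  -- rerouting₁ combines with every outcome of rerouting₀; only three combinations need rerouting₂.
  robust-blue-good-config : RobustBlueGoodConfig c W v j
  robust-blue-good-config
    with rerouting-almost-blue rerouting₀ | rerouting-almost-blue rerouting₁
  ... | inj₁ B₀₂₄        | inj₂ (inj₁ B₂₅₃) = configuration 0F 4F 2F 3F 5F B₀₂₄ B₂₅₃
  ... | inj₂ (inj₁ B₄₅₁) | inj₂ (inj₁ B₂₅₃) = configuration 1F 4F 5F 2F 3F B₄₅₁ B₂₅₃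
  ... | inj₂ (inj₂ B₁₃₆) | inj₂ (inj₁ B₂₅₃) = configuration 1F 6F 3F 2F 5F B₁₃₆ B₂₅₃
  ... | inj₂ (inj₁ B₄₅₁) | inj₁ B₀₁₂        = configuration 4F 5F 1F 0F 2F B₄₅₁ B₀₁₂
  ... | inj₂ (inj₂ B₁₃₆) | inj₁ B₀₁₂        = configuration 3F 6F 1F 0F 2F B₁₃₆ B₀₁₂
  ... | inj₁ B₀₂₄        | inj₁ B₀₁₂ with rerouting-almost-blue rerouting₂
  ...   | inj₁ B₀₄₃        = configuration 1F 2F 0F 3F 4F B₀₁₂ B₀₄₃
  ...   | inj₂ (inj₁ B₃₅₂) = configuration 0F 4F 2F 3F 5F B₀₂₄ B₃₅₂
  ...   | inj₂ (inj₂ B₂₁₆) = configuration 0F 4F 2F 1F 6F B₀₂₄ B₂₁₆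
  robust-blue-good-config | inj₁ B₀₂₄ | inj₂ (inj₂ B₃₄₆) = configuration 0F 2F 4F 3F 6F B₀₂₄ B₃₄₆
  robust-blue-good-config | inj₂ (inj₁ B₄₅₁) | inj₂ (inj₂ B₃₄₆) with rerouting-almost-blue rerouting₂
  ...   | inj₁ B₀₄₃        = configuration 1F 5F 4F 0F 3F B₄₅₁ B₀₄₃
  ...   | inj₂ (inj₁ B₃₅₂) = configuration 1F 4F 5F 2F 3F B₄₅₁ B₃₅₂
  ...   | inj₂ (inj₂ B₂₁₆) = configuration 3F 4F 6F 1F 2F B₃₄₆ B₂₁₆
  robust-blue-good-config | inj₂ (inj₂ B₁₃₆) | inj₂ (inj₂ B₃₄₆) with rerouting-almost-blue rerouting₂
  ...   | inj₁ B₀₄₃        = configuration 1F 6F 3F 0F 4F B₁₃₆ B₀₄₃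
  ...   | inj₂ (inj₁ B₃₅₂) = configuration 1F 6F 3F 2F 5F B₁₃₆ B₃₅₂
  ...   | inj₂ (inj₂ B₂₁₆) = configuration 3F 4F 6F 1F 2F B₃₄₆ B₂₁₆

lemma1 : (N : ℕ) (c : Colouring N) (W : Subset N) (n : ℕ) (v : ℕ → Fin N) →
         IsLoosePath n v → Monochromatic c red n v →
         (∀ k → k ≤ 3 * n → v k ∉ W) → 4 ≤ ∣ W ∣ →
         Maximal c red W n v →
         ∀ j → suc j < n →
         ∃ λ x → ∃ λ a1 → ∃ λ a2 → ∃ λ a3 → ∃ λ a4 → ∃ λ a5 → ∃ λ y →
           BlueGoodConfig c W v j x a1 a2 a3 a4 a5 y
           × (Σ (Subset N) λ W₁ → Σ (Subset N) λ W₂ →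
                W₁ ⊆ W × W₂ ⊆ W × ∣ W ∣ ∸ 2 ≤ ∣ W₁ ∣ × ∣ W ∣ ∸ 3 ≤ ∣ W₂ ∣
                × (∀ x′ y′ → x′ ∈ W₁ → y′ ∈ W₂ → x′ ≢ y′ →
                     BlueGoodConfig c W v j x′ a1 a2 a3 a4 a5 y′))
lemma1 N c W n v isLP mono v∉W 4≤∣W∣ maximal j j+1<n =
  Segment.robust-blue-good-config c W n v isLP mono v∉W 4≤∣W∣ maximal j j+1<n
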